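{- For any partition $\lambda$ and part $i$ of $\lambda$, $$t\,e_{\lambda,i}=e_\lambda-e_{\lambda^{\uparrow i},i+1}=e_{\lambda\cup1,1}-e_{\lambda^{\uparrow i},i+1},$$ where $\lambda^{\uparrow i}$ is obtained from $\lambda$ by replacing one copy of the part $i$ by $i+1$, and $\lambda\cup1$ is $\lambda$ with a part $1$ added.
   Context: $\Lambda$ is the ring of symmetric functions, $e_k$ elementary symmetric functions ($e_0=1$), $e_\mu=\prod_je_{\mu_j}$. Pointed elementary symmetric functions in $\Lambda[t]$: $e_{i,i}=\sum_{k=1}^i(-t)^{k-1}e_{i-k}$ (equal to the pointed Schur function $s_{(1^i),1}$), and for a partition $\mu$ with a part $i$, $e_{\mu,i}=e_{i,i}\prod_{j\in\mu\setminus i}e_j$, where $\mu\setminus i$ is $\mu$ with one copy of $i$ deleted. -}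

module Defs where

open import Algebra.Bundles using (CommutativeRing)
open import Data.Nat using (ℕ; zero; suc; _≟_; _≥_; _≤_; _∸_)
open import Data.List using (List; []; _∷_)
open import Data.List.Relation.Unary.All using (All)
open import Data.List.Relation.Unary.Linked using (Linked)
open import Data.Product using (_×_)
open import Relation.Nullary using (yes; no)

IsPartition : List ℕ → Set
IsPartition μ = Linked _≥_ μ × All (1 ≤_) μ

remove1 : ℕ → List ℕ → List ℕ
remove1 i [] = []
remove1 i (x ∷ xs) with i ≟ x
... | yes _ = xs
... | no  _ = x ∷ remove1 i xs

-- μ^{↑i} : replace one copy (the first occurrence) of the part i by i+1.
-- (Replacing the first occurrence keeps the list weakly decreasing.)
bump : ℕ → List ℕ → List ℕ
bump i [] = []
bump i (x ∷ xs) with i ≟ x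
... | yes _ = suc i ∷ xs
... | no  _ = x ∷ bump i xs

-- Symmetric-function expressions, evaluated in a commutative ring R
-- (intended: R = Λ[t]) given t and the elementary functions e : ℕ → R.
module Sym {c ℓ} (R : CommutativeRing c ℓ)
           (t : CommutativeRing.Carrier R)
           (e : ℕ → CommutativeRing.Carrier R) where
  open CommutativeRing R

  pow : Carrier → ℕ → Carrier
  pow x zero    = 1#
  pow x (suc n) = pow x n * x

  sumFrom1 : ℕ → (ℕ → Carrier) → Carrier
  sumFrom1 zero    f = 0#
  sumFrom1 (suc n) f = sumFrom1 n f + f (suc n)

  eProd : List ℕ → Carrier
  eProd []       = 1#
  eProd (j ∷ μ)  = e j * eProd μ

  -- e_{i,i} = Σ_{k=1}^{i} (-t)^{k-1} e_{i-k}
  ePt : ℕ → Carrier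
  ePt i = sumFrom1 i (λ k → pow (- t) (k ∸ 1) * e (i ∸ k))

  -- e_{μ,i} = e_{i,i} ∏_{j ∈ μ \ i} e_j
  ePtd : List ℕ → ℕ → Carrier
  ePtd μ i = ePt i * eProd (remove1 i μ)

-- Everything follows from the recursion e_{i+1,i+1} = e_i − t e_{i,i}, read off the
-- defining sum by splitting off its k = 1 term.  Multiplying t e_{i,i} = e_i − e_{i+1,i+1}
-- by ∏_{j ∈ λ∖i} e_j gives the first identity, because λ = (λ∖i) ∪ {i} and
-- λ^{↑i} ∖ (i+1) = λ ∖ i as multisets.  The second holds since e_{1,1} = e_0 = 1.
-- Neither uses that λ is a partition.
module Submission where

open import Defs
open import Algebra.Bundles using (CommutativeRing)
open import Data.Nat using (ℕ; suc; zero; _≟_; _∸_)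
open import Data.Nat.Properties using (≟-diag)
open import Data.List using (List; _∷_; []; _++_)
open import Data.List.Membership.Propositional using (_∈_)
open import Data.List.Relation.Unary.Any using (here; there)
open import Data.Product using (_×_; _,_)
open import Data.Empty using (⊥-elim)
open import Function using (_∘_)
open import Relation.Nullary using (yes; no)
import Relation.Binary.PropositionalEquality as ≡

module PointedElementary {c ℓ} (R : CommutativeRing c ℓ)
                         (t : CommutativeRing.Carrier R)
                         (e : ℕ → CommutativeRing.Carrier R) where
  open CommutativeRing R
  open Sym R t e
  open import Relation.Binary.Reasoning.Setoid setoid
  open import Algebra.Properties.Ring ring
    using (-‿distribˡ-*; [y-z]x≈yx-zx; ⁻¹-anti-homo‿-; xyx⁻¹≈y)
  open import Algebra.Properties.CommutativeSemigroup *-commutativeSemigroup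
    using (x∙yz≈y∙xz; xy∙z≈y∙xz)

  sumFrom1-cong : ∀ n {f g : ℕ → Carrier} → (∀ k → f (suc k) ≈ g (suc k)) →
                  sumFrom1 n f ≈ sumFrom1 n g
  sumFrom1-cong zero    f≈g = refl
  sumFrom1-cong (suc n) f≈g = +-cong (sumFrom1-cong n f≈g) (f≈g n)

  sumFrom1-suc : ∀ n (f : ℕ → Carrier) →
                 sumFrom1 (suc n) f ≈ f 1 + sumFrom1 n (f ∘ suc)
  sumFrom1-suc zero    f = +-comm 0# (f 1)
  sumFrom1-suc (suc n) f = begin
    sumFrom1 (suc n) f + f (suc (suc n))            ≈⟨ +-congʳ (sumFrom1-suc n f) ⟩
    f 1 + sumFrom1 n (f ∘ suc) + f (suc (suc n))    ≈⟨ +-assoc _ _ _ ⟩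
    f 1 + (sumFrom1 n (f ∘ suc) + f (suc (suc n)))  ∎

  *-distribˡ-sumFrom1 : ∀ n x (f : ℕ → Carrier) →
                        x * sumFrom1 n f ≈ sumFrom1 n (λ k → x * f k)
  *-distribˡ-sumFrom1 zero    x f = zeroʳ x
  *-distribˡ-sumFrom1 (suc n) x f = begin
    x * (sumFrom1 n f + f (suc n))              ≈⟨ distribˡ x _ _ ⟩
    x * sumFrom1 n f + x * f (suc n)            ≈⟨ +-congʳ (*-distribˡ-sumFrom1 n x f) ⟩
    sumFrom1 n (λ k → x * f k) + x * f (suc n)  ∎

  ePt-suc : ∀ i → ePt (suc i) ≈ e i - t * ePt i
  ePt-suc i = begin
    ePt (suc i)
      ≈⟨ sumFrom1-suc i _ ⟩
    1# * e i + sumFrom1 i (λ k → pow (- t) k * e (i ∸ k))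
      ≈⟨ +-cong (*-identityˡ _) (sumFrom1-cong i λ _ → xy∙z≈y∙xz _ _ _) ⟩
    e i + sumFrom1 i (λ k → - t * (pow (- t) (k ∸ 1) * e (i ∸ k)))
      ≈⟨ +-congˡ (*-distribˡ-sumFrom1 i (- t) _) ⟨
    e i + - t * ePt i
      ≈⟨ +-congˡ (-‿distribˡ-* t (ePt i)) ⟨
    e i - t * ePt i
      ∎

  t*ePt : ∀ i → t * ePt i ≈ e i - ePt (suc i)
  t*ePt i = begin
    t * ePt i                  ≈⟨ xyx⁻¹≈y (e i) (t * ePt i) ⟨
    e i + t * ePt i - e i      ≈⟨ +-assoc _ _ _ ⟩
    e i + (t * ePt i - e i)    ≈⟨ +-congˡ (⁻¹-anti-homo‿- (e i) (t * ePt i)) ⟨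
    e i - (e i - t * ePt i)    ≈⟨ +-congˡ (-‿cong (ePt-suc i)) ⟨
    e i - ePt (suc i)          ∎

  eProd-remove1 : ∀ i μ → i ∈ μ → eProd μ ≈ e i * eProd (remove1 i μ)
  eProd-remove1 i (x ∷ xs) i∈μ with i ≟ x
  eProd-remove1 i (x ∷ xs) i∈μ          | yes ≡.refl = refl
  eProd-remove1 i (x ∷ xs) (here i≡x)   | no i≢x     = ⊥-elim (i≢x i≡x)
  eProd-remove1 i (x ∷ xs) (there i∈xs) | no _       = begin
    e x * eProd xs                        ≈⟨ *-congˡ (eProd-remove1 i xs i∈xs) ⟩
    e x * (e i * eProd (remove1 i xs))    ≈⟨ x∙yz≈y∙xz _ _ _ ⟩
    e i * (e x * eProd (remove1 i xs))    ∎

  eProd-bump : ∀ i μ → i ∈ μ → eProd (bump i μ) ≈ e (suc i) * eProd (remove1 i μ)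
  eProd-bump i (x ∷ xs) i∈μ with i ≟ x
  eProd-bump i (x ∷ xs) i∈μ          | yes ≡.refl = refl
  eProd-bump i (x ∷ xs) (here i≡x)   | no i≢x     = ⊥-elim (i≢x i≡x)
  eProd-bump i (x ∷ xs) (there i∈xs) | no _       = begin
    e x * eProd (bump i xs)                     ≈⟨ *-congˡ (eProd-bump i xs i∈xs) ⟩
    e x * (e (suc i) * eProd (remove1 i xs))    ≈⟨ x∙yz≈y∙xz _ _ _ ⟩
    e (suc i) * (e x * eProd (remove1 i xs))    ∎

  -- The two lists differ when a part i+1 precedes the first part i: then remove1 deletes
  -- that earlier i+1 instead of the bumped part.
  eProd-remove1-bump : ∀ i μ → i ∈ μ →
                       eProd (remove1 (suc i) (bump i μ)) ≈ eProd (remove1 i μ)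
  eProd-remove1-bump i (x ∷ xs) i∈μ with i ≟ x
  eProd-remove1-bump i (x ∷ xs) i∈μ          | yes ≡.refl rewrite ≟-diag {suc i} ≡.refl = refl
  eProd-remove1-bump i (x ∷ xs) (here i≡x)   | no i≢x     = ⊥-elim (i≢x i≡x)
  eProd-remove1-bump i (x ∷ xs) (there i∈xs) | no _ with suc i ≟ x
  ... | yes ≡.refl = eProd-bump i xs i∈xs
  ... | no _       = *-congˡ (eProd-remove1-bump i xs i∈xs)

  eProd-∷ʳ : ∀ j μ → eProd (μ ++ j ∷ []) ≈ e j * eProd μ
  eProd-∷ʳ j []       = refl
  eProd-∷ʳ j (x ∷ xs) = trans (*-congˡ (eProd-∷ʳ j xs)) (x∙yz≈y∙xz _ _ _)

  eProd-remove1-∷ʳ : ∀ j μ → eProd (remove1 j (μ ++ j ∷ [])) ≈ eProd μ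
  eProd-remove1-∷ʳ j [] rewrite ≟-diag {j} ≡.refl = refl
  eProd-remove1-∷ʳ j (x ∷ xs) with j ≟ x
  ... | yes ≡.refl = eProd-∷ʳ j xs
  ... | no _       = *-congˡ (eProd-remove1-∷ʳ j xs)

  t*ePtd : ∀ μ i → i ∈ μ → t * ePtd μ i ≈ eProd μ - ePtd (bump i μ) (suc i)
  t*ePtd μ i i∈μ = begin
    t * (ePt i * eProd (remove1 i μ))
      ≈⟨ *-assoc _ _ _ ⟨
    t * ePt i * eProd (remove1 i μ)
      ≈⟨ *-congʳ (t*ePt i) ⟩
    (e i - ePt (suc i)) * eProd (remove1 i μ)
      ≈⟨ [y-z]x≈yx-zx _ _ _ ⟩
    e i * eProd (remove1 i μ) - ePt (suc i) * eProd (remove1 i μ)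
      ≈⟨ +-cong (eProd-remove1 i μ i∈μ) (-‿cong (*-congˡ (eProd-remove1-bump i μ i∈μ))) ⟨
    eProd μ - ePt (suc i) * eProd (remove1 (suc i) (bump i μ))
      ∎

  ePtd-∷ʳ-1 : e 0 ≈ 1# → ∀ μ → ePtd (μ ++ 1 ∷ []) 1 ≈ eProd μ
  ePtd-∷ʳ-1 e₀≈1 μ = begin
    ePt 1 * eProd (remove1 1 (μ ++ 1 ∷ []))  ≈⟨ *-cong ePt-1 (eProd-remove1-∷ʳ 1 μ) ⟩
    1# * eProd μ                             ≈⟨ *-identityˡ _ ⟩
    eProd μ                                  ∎
    where
    ePt-1 : ePt 1 ≈ 1#
    ePt-1 = trans (+-identityˡ _) (trans (*-identityˡ _) e₀≈1)

proposition4p4 : ∀ {c ℓ} (R : CommutativeRing c ℓ) →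
    let open CommutativeRing R in
    (t : Carrier) (e : ℕ → Carrier) → e 0 ≈ 1# →
    (μ : List ℕ) → IsPartition μ → (i : ℕ) → i ∈ μ →
    (t * Sym.ePtd R t e μ i
       ≈ Sym.eProd R t e μ - Sym.ePtd R t e (bump i μ) (suc i))
    × (Sym.eProd R t e μ - Sym.ePtd R t e (bump i μ) (suc i)
       ≈ Sym.ePtd R t e (μ ++ (1 ∷ [])) 1 - Sym.ePtd R t e (bump i μ) (suc i))
proposition4p4 R t e e₀≈1 μ _ i i∈μ =
  t*ePtd μ i i∈μ , +-congʳ (sym (ePtd-∷ʳ-1 e₀≈1 μ))
  where
  open CommutativeRing R
  open PointedElementary R t e
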